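{- Let $\pi\in I(321)$ be an involution without fixed points whose plot has no couple of symmetric connections. Then either $\pi$ is simple, or $\pi=12[\alpha_1,\alpha_2]$ with $\alpha_1$ simple.
   Context: A permutation of length $n$ is a bijection of $\{1,\dots,n\}$ in one-line notation. A permutation avoids $321$ if it has no indices $i<j<k$ with $\pi(i)>\pi(j)>\pi(k)$. An involution satisfies $\pi(\pi(i))=i$ for all $i$; $I(321)$ is the set of involutions avoiding $321$. An interval of a permutation of length $n$ is a set of contiguous positions whose image is a set of contiguous integers; a permutation is simple if its only intervals are the empty set, singletons and $[1,n]$. For nonempty $\alpha_1$ of length $a$ and $\alpha_2$ of length $b$, $12[\alpha_1,\alpha_2]$ is the permutation $\alpha_1(1)\cdots\alpha_1(a)\,(a+\alpha_2(1))\cdots(a+\alpha_2(b))$. For an involution $\pi$ without fixed points, write $\pi=(m_1,M_1)\cdots(m_m,M_m)$ with $m_i<M_i$, $m_1<\cdots<m_m$; the plot is the polygonal line joining $(1,\pi(1)),\dots,(n,\pi(n))$ in order; maxima are the points $(m_i,M_i)$ (above $y=x$), minima the points $(M_i,m_i)$ (below $y=x$). Two maxima (resp. minima) are up-connected (resp. down-connected) if they occur at consecutive positions of $\pi$, i.e. are joined by one segment of the plot. A couple of symmetric connections is an up-connection between two maxima together with a down-connection between the two minima that are their mirror images in the line $y=x$. -}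

module Defs where

open import Data.Nat using (ℕ; zero; suc; _+_; _<_; _≤_)
open import Data.Fin using (Fin; toℕ; cast; _↑ˡ_; _↑ʳ_)
open import Data.Fin.Permutation using (Permutation′; _⟨$⟩ʳ_)
open import Data.Product using (Σ; ∃; _×_; _,_)
open import Data.Sum using (_⊎_)
open import Relation.Nullary using (¬_)
open import Relation.Binary.PropositionalEquality using (_≡_; _≢_)

-- Permutations of length n are bijections Fin n ↔ Fin n (positions and
-- values are shifted down by one: position i ∈ {1..n} is Fin index i-1).
-- We write π ⟨$⟩ʳ i for π(i) and compare via toℕ.

Avoids321 : ∀ {n} → Permutation′ n → Set
Avoids321 {n} π =
  ¬ (Σ (Fin n) λ i → Σ (Fin n) λ j → Σ (Fin n) λ k →
       (toℕ i < toℕ j) × (toℕ j < toℕ k) ×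
       (toℕ (π ⟨$⟩ʳ j) < toℕ (π ⟨$⟩ʳ i)) × (toℕ (π ⟨$⟩ʳ k) < toℕ (π ⟨$⟩ʳ j)))

IsInvolution : ∀ {n} → Permutation′ n → Set
IsInvolution {n} π = ∀ (i : Fin n) → π ⟨$⟩ʳ (π ⟨$⟩ʳ i) ≡ i

FixedPointFree : ∀ {n} → Permutation′ n → Set
FixedPointFree {n} π = ∀ (i : Fin n) → π ⟨$⟩ʳ i ≢ i

-- The (nonempty) set of contiguous positions [a, b] (a ≤ b) is an interval
-- of π: its image is a set of contiguous integers, i.e. whenever two values
-- π(i), π(j) (i, j ∈ [a,b]) lie below and above v, then v = π(k) for some
-- k ∈ [a,b].
IsInterval : ∀ {n} → Permutation′ n → ℕ → ℕ → Set
IsInterval {n} π a b =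
  ∀ (i j : Fin n) (v : Fin n) →
    a ≤ toℕ i → toℕ i ≤ b → a ≤ toℕ j → toℕ j ≤ b →
    toℕ (π ⟨$⟩ʳ i) ≤ toℕ v → toℕ v ≤ toℕ (π ⟨$⟩ʳ j) →
    Σ (Fin n) λ k → (a ≤ toℕ k) × (toℕ k ≤ b) × (π ⟨$⟩ʳ k ≡ v)

-- π is simple: every nonempty set of contiguous positions [a,b] ⊆ [0,n-1]
-- which is an interval is a singleton (a = b) or everything (a = 0, b = n-1).
-- (The empty set is always an interval and trivially allowed.)
IsSimple : ∀ {n} → Permutation′ n → Set
IsSimple {n} π =
  ∀ (a b : ℕ) → a ≤ b → suc b ≤ n → IsInterval π a b →
    (a ≡ b) ⊎ ((a ≡ 0) × (suc b ≡ n))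

-- π = 12[α₁, α₂] with α₁ of length a ≥ 1, α₂ of length b ≥ 1, a + b = n.
-- Fin (a + b) = Fin n via cast; i ↑ˡ b is position i of the first block,
-- a ↑ʳ j is position a + j.
Is12Sum : ∀ {n a b} → (e : a + b ≡ n) → Permutation′ n →
          Permutation′ a → Permutation′ b → Set
Is12Sum {n} {a} {b} e π α₁ α₂ =
  (∀ (i : Fin a) → π ⟨$⟩ʳ cast e (i ↑ˡ b) ≡ cast e ((α₁ ⟨$⟩ʳ i) ↑ˡ b)) ×
  (∀ (j : Fin b) → π ⟨$⟩ʳ cast e (a ↑ʳ j) ≡ cast e (a ↑ʳ (α₂ ⟨$⟩ʳ j)))

-- A point (p, π(p)) is a maximum if p < π(p) (above y = x).
-- Two maxima are up-connected if they are at consecutive positions p, p+1.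
-- Their mirror images are the minima at positions π(p), π(p+1); those are
-- down-connected iff these positions are consecutive.
-- A couple of symmetric connections: both happen.
HasSymmetricConnections : ∀ {n} → Permutation′ n → Set
HasSymmetricConnections {n} π =
  Σ (Fin n) λ p → Σ (Fin n) λ q →
    (toℕ q ≡ suc (toℕ p)) ×
    (toℕ p < toℕ (π ⟨$⟩ʳ p)) × (toℕ q < toℕ (π ⟨$⟩ʳ q)) ×
    ((toℕ (π ⟨$⟩ʳ q) ≡ suc (toℕ (π ⟨$⟩ʳ p))) ⊎
     (toℕ (π ⟨$⟩ʳ p) ≡ suc (toℕ (π ⟨$⟩ʳ q))))

module Submission where

-- Extend π to an involution F of ℕ (identity from n on) and let
-- A be the least positive number such that the prefix [0, A) is closed under
-- F; it exists because [0, n) is closed.  If A = n we show that π is simple,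
-- if A < n then π = 12[α₁, α₂] with α₁ = π restricted to [0, A), and we show
-- that α₁ is simple.  Both statements follow from one fact about the first
-- block [0, A): every interval [x, y] with x < y < A is the whole block.
--
-- For that fact, an interval [x, y] and its image [c, d] (from its least
-- to its greatest value) are exchanged by F, as F is an involution.
-- Three combinatorial facts about exchanged segments of a fixed-point-free
-- 321-avoiding involution settle all relative positions: an F-stable segment
-- of the first block is the block itself (else a shorter closed prefix
-- exists); disjoint exchanged segments produce a couple of symmetric
-- connections; overlapping ones starting at 0 produce a 321 pattern or a
-- couple of symmetric connections.

open import Defs
open import Data.Nat using (ℕ; zero; suc; _+_; _∸_; _<_; _≤_; _≤′_; ≤′-refl; ≤′-step; z≤n; s≤s; z<s; _<?_; _≤?_; _≟_)
open import Data.Nat.Properties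
open import Data.Nat.Induction using (<-rec)
open import Data.Fin using (Fin; toℕ; fromℕ<; cast; _↑ˡ_; _↑ʳ_)
open import Data.Fin.Properties using (toℕ-injective; toℕ-fromℕ<; fromℕ<-toℕ; toℕ<n; toℕ-cast; toℕ-↑ˡ; toℕ-↑ʳ)
open import Data.Fin.Permutation using (Permutation′; _⟨$⟩ʳ_; permutation)
open import Data.Product using (Σ; ∃-syntax; _×_; _,_; proj₁; proj₂)
open import Data.Sum using (_⊎_; inj₁; inj₂; [_,_]′)
open import Data.Empty using (⊥; ⊥-elim)
open import Function using (_∘_; id)
open import Relation.Nullary using (¬_; Dec; yes; no; contradiction)
open import Relation.Nullary.Decidable using (_×-dec_)
open import Relation.Binary.PropositionalEquality
open import Relation.Binary.Definitions using (tri<; tri≈; tri>)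

_∈[_,_] : ℕ → ℕ → ℕ → Set
t ∈[ s , e ] = s ≤ t × t ≤ e

MapsInto : (ℕ → ℕ) → ℕ → ℕ → ℕ → ℕ → Set
MapsInto F a b c d = ∀ {t} → t ∈[ a , b ] → F t ∈[ c , d ]

ClosedPrefix : (ℕ → ℕ) → ℕ → Set
ClosedPrefix F L = ∀ {t} → t < L → F t < L

-- Closedness of a prefix is decidable, so a least closed prefix exists.
closedPrefix? : (F : ℕ → ℕ) → ∀ L → Dec (ClosedPrefix F L)
closedPrefix? F L = allUpTo? (λ t → F t <? L) L

-- The segment [x, y] is an interval of F: the values F takes on it form a
-- segment.  This is IsInterval of Defs, read on ℕ instead of Fin n.
IsSegmentInterval : (ℕ → ℕ) → ℕ → ℕ → Set
IsSegmentInterval F x y =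
  ∀ {i j v} → i ∈[ x , y ] → j ∈[ x , y ] → F i ≤ v → v ≤ F j →
    ∃[ k ] k ∈[ x , y ] × F k ≡ v

least : {P : ℕ → Set} → (∀ m → Dec (P m)) →
  ∀ {m} → P m → ∃[ A ] A ≤ m × P A × (∀ {L} → L < A → ¬ P L)
least {P} P? {m} = <-rec Least search m
  where
  Least : ℕ → Set
  Least m = P m → ∃[ A ] A ≤ m × P A × (∀ {L} → L < A → ¬ P L)
  search : ∀ m → (∀ {k} → k < m → Least k) → Least m
  search m smaller Pm with anyUpTo? P? m
  ... | no noneBelow = m , ≤-refl , Pm , λ L<m PL → noneBelow (_ , L<m , PL)
  ... | yes (k , k<m , Pk) with smaller k<m Pk
  ...   | A , A≤k , PA , minimal = A , ≤-trans A≤k (<⇒≤ k<m) , PA , minimal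

extendSegment : {P : ℕ → Set} → ∀ {x y} → (∀ {t} → t ∈[ x , y ] → P t) →
  P (suc y) → ∀ {t} → t ∈[ x , suc y ] → P t
extendSegment onSegment atNext (x≤t , t≤y+1) with m≤n⇒m<n∨m≡n t≤y+1
... | inj₁ t<y+1 = onSegment (x≤t , ≤-pred t<y+1)
... | inj₂ refl = atNext

reflexiveOfTotal : {R : ℕ → ℕ → Set} → (∀ p q → R p q ⊎ R q p) → ∀ p → R p p
reflexiveOfTotal total p = [ id , id ]′ (total p p)

-- A nonempty segment [x, y] contains an element i that is R-below all its
-- elements, for R total and transitive; used for the least and the greatest
-- value of a function on a segment.
extremum : {R : ℕ → ℕ → Set} → (∀ p q → R p q ⊎ R q p) →
  (∀ {p q r} → R p q → R q r → R p r) →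
  ∀ {x y} → x ≤′ y → ∃[ i ] i ∈[ x , y ] × (∀ {t} → t ∈[ x , y ] → R i t)
extremum {R} total _ {x} ≤′-refl =
  x , (≤-refl , ≤-refl) ,
  λ (x≤t , t≤x) → subst (R x) (≤-antisym x≤t t≤x) (reflexiveOfTotal total x)
extremum total transitive {x} (≤′-step {y} x≤′y)
  with extremum total transitive x≤′y
... | i , (x≤i , i≤y) , below with total i (suc y)
...   | inj₁ Ri[y+1] = i , (x≤i , m≤n⇒m≤1+n i≤y) , extendSegment below Ri[y+1]
...   | inj₂ R[y+1]i =
  suc y , (≤′⇒≤ (≤′-step x≤′y) , ≤-refl) ,
  extendSegment (transitive R[y+1]i ∘ below) (reflexiveOfTotal total (suc y))

exchangedUnionStable : ∀ {F a b c d} → a ≤ c → c ≤ b → b ≤ d →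
  MapsInto F a b c d → MapsInto F c d a b → MapsInto F a d a d
exchangedUnionStable {b = b} a≤c c≤b b≤d into out {t} (a≤t , t≤d) with t ≤? b
... | yes t≤b = let (c≤Ft , Ft≤d) = into (a≤t , t≤b) in ≤-trans a≤c c≤Ft , Ft≤d
... | no t≰b = let (a≤Ft , Ft≤b) = out (≤-trans c≤b (<⇒≤ (≰⇒> t≰b)) , t≤d)
               in a≤Ft , ≤-trans Ft≤b b≤d

module Involution (F : ℕ → ℕ) (involutive : ∀ t → F (F t) ≡ t) where

  injective : ∀ {p q} → F p ≡ F q → p ≡ q
  injective {p} {q} Fp≡Fq = trans (sym (involutive p)) (trans (cong F Fp≡Fq) (involutive q))

  swap : ∀ {p q} → F p ≡ q → F q ≡ p
  swap {p} Fp≡q = trans (cong F (sym Fp≡q)) (involutive p)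

  beyondClosedPrefix : ∀ {A t} → ClosedPrefix F A → A ≤ t → A ≤ F t
  beyondClosedPrefix {A} {t} closed A≤t with F t <? A
  ... | no Ft≮A = ≮⇒≥ Ft≮A
  ... | yes Ft<A = contradiction (subst (_< A) (involutive t) (closed Ft<A)) (≤⇒≯ A≤t)

module FirstBlock
  (F : ℕ → ℕ)
  (involutive : ∀ t → F (F t) ≡ t)
  (avoids321 : ∀ {i j k} → i < j → j < k → F j < F i → F k < F j → ⊥)
  (noSymmetricConnection :
     ∀ {p} → p < F p → suc p < F (suc p) → F (suc p) ≡ suc (F p) → ⊥)
  (A : ℕ)
  (fixedPointFree : ∀ {t} → t < A → F t ≢ t)
  (closedA : ClosedPrefix F A)
  (minimalA : ∀ {L} → L < A → ¬ (0 < L × ClosedPrefix F L))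
  where

  open Involution F involutive

  -- No value before an excedance j (j < F j) exceeds F j: otherwise
  -- i < j < F j would carry the values F i > F j > F (F j) = j.
  excedanceDominates : ∀ {i j} → i < j → j < F j → F j < F i → ⊥
  excedanceDominates {j = j} i<j j<Fj Fj<Fi =
    avoids321 i<j j<Fj Fj<Fi (subst (_< F j) (sym (involutive j)) j<Fj)

  earlierBelowExcedance : ∀ {i j} → i < j → j < F j → F i < F j
  earlierBelowExcedance i<j j<Fj =
    ≤∧≢⇒< (≮⇒≥ (excedanceDominates i<j j<Fj)) (<⇒≢ i<j ∘ injective)

  -- A segment [s, e] of the block mapped into itself starts at 0: if s > 0
  -- then [0, s) is closed, because a t < s with F t ≥ s would have F t > e
  -- (else F (F t) = t ≥ s) and then F t > F s > s would violate
  -- excedanceDominates.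
  stableStartsAt0 : ∀ {s e} → s ≤ e → e < A → MapsInto F s e s e → s ≡ 0
  stableStartsAt0 {zero} _ _ _ = refl
  stableStartsAt0 {suc s} {e} s<e e<A stable =
    contradiction (z<s , λ {_} → closed) (minimalA (≤-<-trans s<e e<A))
    where
    S<FS : suc s < F (suc s)
    S<FS = ≤∧≢⇒< (proj₁ (stable (≤-refl , s<e)))
                 (fixedPointFree (≤-<-trans s<e e<A) ∘ sym)
    closed : ClosedPrefix F (suc s)
    closed {t} t<S with F t <? suc s | F t ≤? e
    ... | yes Ft<S | _ = Ft<S
    ... | no Ft≮S | yes Ft≤e =
      contradiction (subst (suc s ≤_) (involutive t) (proj₁ (stable (≮⇒≥ Ft≮S , Ft≤e))))
                    (<⇒≱ t<S)
    ... | no _ | no Ft≰e = ⊥-elim (excedanceDominates t<S S<FS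
      (≤-<-trans (proj₂ (stable (≤-refl , s<e))) (≰⇒> Ft≰e)))

  stableIsBlock : ∀ {s e} → s ≤ e → e < A → MapsInto F s e s e → s ≡ 0 × suc e ≡ A
  stableIsBlock s≤e e<A stable with stableStartsAt0 s≤e e<A stable
  ... | refl with m≤n⇒m<n∨m≡n e<A
  ...   | inj₂ e+1≡A = refl , e+1≡A
  ...   | inj₁ e+1<A =
    contradiction (z<s , λ {_} t<e+1 → s≤s (proj₂ (stable (z≤n , ≤-pred t<e+1))))
                  (minimalA e+1<A)

  -- F cannot exchange [a, b] and [c, d] when a < b < c: the positions a and
  -- a + 1 are excedances with F a < F (a + 1), and a value v strictly
  -- between them would come from a position k = F v with a + 1 < k < v,
  -- violating excedanceDominates; so F (a + 1) = F a + 1, a couple of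
  -- symmetric connections.
  disjointExchange : ∀ {a b c d} → a < b → b < c →
    MapsInto F a b c d → MapsInto F c d a b → ⊥
  disjointExchange {a} {b} {c} {d} a<b b<c into out =
    noSymmetricConnection a<Fa a+1<F[a+1] adjacentValues
    where
    c≤Fa : c ≤ F a
    c≤Fa = proj₁ (into (≤-refl , <⇒≤ a<b))
    F[a+1]≤d : F (suc a) ≤ d
    F[a+1]≤d = proj₂ (into (n≤1+n a , a<b))
    a<Fa : a < F a
    a<Fa = <-≤-trans (<-trans a<b b<c) c≤Fa
    a+1<F[a+1] : suc a < F (suc a)
    a+1<F[a+1] = <-≤-trans (≤-<-trans a<b b<c) (proj₁ (into (n≤1+n a , a<b)))
    adjacentValues : F (suc a) ≡ suc (F a)
    adjacentValues with m≤n⇒m<n∨m≡n (earlierBelowExcedance (n<1+n a) a+1<F[a+1])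
    ... | inj₂ Fa+1≡F[a+1] = sym Fa+1≡F[a+1]
    ... | inj₁ Fa+1<F[a+1] = ⊥-elim (excedanceDominates a+1<k k<Fk Fk<F[a+1])
      where
      v = suc (F a)
      k = F v
      Fk≡v : F k ≡ v
      Fk≡v = involutive v
      k∈[a,b] : k ∈[ a , b ]
      k∈[a,b] = out (m≤n⇒m≤1+n c≤Fa , ≤-trans (<⇒≤ Fa+1<F[a+1]) F[a+1]≤d)
      k≢a : k ≢ a
      k≢a k≡a = <-irrefl (trans (cong F (sym k≡a)) Fk≡v) (n<1+n (F a))
      k≢a+1 : k ≢ suc a
      k≢a+1 k≡a+1 = <-irrefl (trans (sym Fk≡v) (cong F k≡a+1)) Fa+1<F[a+1]
      a+1<k : suc a < k
      a+1<k = ≤∧≢⇒< (≤∧≢⇒< (proj₁ k∈[a,b]) (k≢a ∘ sym)) (k≢a+1 ∘ sym)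
      k<Fk : k < F k
      k<Fk = subst (k <_) (sym Fk≡v) (≤-<-trans (proj₂ k∈[a,b]) (<-≤-trans b<c (m≤n⇒m≤1+n c≤Fa)))
      Fk<F[a+1] : F k < F (suc a)
      Fk<F[a+1] = subst (_< F (suc a)) (sym Fk≡v) Fa+1<F[a+1]

  -- If F exchanges [0, b] and [c, d] with 0 < c ≤ b < d, then F 0 = b + 1:
  -- a value F 0 ≤ b would be sent back to 0 ∈ [c, d], and a value
  -- F 0 > b + 1 violates excedanceDominates at the position w = F (b + 1),
  -- which lies in [1, b].
  overlapStartsAbove : ∀ {b c d} → 0 < c → c ≤ b → b < d →
    MapsInto F 0 b c d → MapsInto F c d 0 b → F 0 ≡ suc b
  overlapStartsAbove {b} {c} 0<c c≤b b<d into out with <-cmp (F 0) (suc b)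
  ... | tri< F0≤b _ _ =
    contradiction (subst (c ≤_) (involutive 0) (proj₁ (into (z≤n , ≤-pred F0≤b)))) (<⇒≱ 0<c)
  ... | tri≈ _ F0≡b+1 _ = F0≡b+1
  ... | tri> _ _ b+1<F0 =
    ⊥-elim (excedanceDominates 0<w w<Fw (subst (_< F 0) (sym Fw≡b+1) b+1<F0))
    where
    w = F (suc b)
    Fw≡b+1 : F w ≡ suc b
    Fw≡b+1 = involutive (suc b)
    w<Fw : w < F w
    w<Fw = subst (w <_) (sym Fw≡b+1) (s≤s (proj₂ (out (m≤n⇒m≤1+n c≤b , b<d))))
    0<w : 0 < w
    0<w = n≢0⇒n>0 (λ w≡0 → <-irrefl (trans (sym Fw≡b+1) (cong F w≡0)) b+1<F0)

  -- Hence F cannot exchange [0, b] and [c, d] when 0 < c ≤ b < d < A: the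
  -- excedance 1 has F 1 > F 0 = b + 1; F 1 = b + 2 is a couple of symmetric
  -- connections, and F 1 > b + 2 violates excedanceDominates at the position
  -- u = F (b + 2), which lies in [2, b].
  overlapExchangeFrom0 : ∀ {b c d} → 0 < c → c ≤ b → b < d → d < A →
    MapsInto F 0 b c d → MapsInto F c d 0 b → ⊥
  overlapExchangeFrom0 {b} {c} {d} 0<c c≤b b<d d<A into out =
    beyondF0 (m≤n⇒m<n∨m≡n (subst (_< F 1) F0≡b+1 (earlierBelowExcedance z<s 1<F1)))
    where
    F0≡b+1 : F 0 ≡ suc b
    F0≡b+1 = overlapStartsAbove 0<c c≤b b<d into out
    1≤b : 1 ≤ b
    1≤b = ≤-trans 0<c c≤b
    1<F1 : 1 < F 1
    1<F1 = ≤∧≢⇒< (≤-trans 0<c (proj₁ (into (z≤n , 1≤b))))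
                 (fixedPointFree (≤-<-trans 1≤b (<-trans b<d d<A)) ∘ sym)
    beyondF0 : suc (suc b) < F 1 ⊎ suc (suc b) ≡ F 1 → ⊥
    beyondF0 (inj₂ b+2≡F1) =
      noSymmetricConnection (subst (0 <_) (sym F0≡b+1) z<s) 1<F1
        (trans (sym b+2≡F1) (cong suc (sym F0≡b+1)))
    beyondF0 (inj₁ b+2<F1) = excedanceDominates 1<u u<Fu Fu<F1
      where
      u = F (suc (suc b))
      Fu≡b+2 : F u ≡ suc (suc b)
      Fu≡b+2 = involutive (suc (suc b))
      u≤b : u ≤ b
      u≤b = proj₂ (out (≤-trans c≤b (≤-trans (n≤1+n b) (n≤1+n (suc b))) ,
                        ≤-trans (<⇒≤ b+2<F1) (proj₂ (into (z≤n , 1≤b)))))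
      u≢0 : u ≢ 0
      u≢0 u≡0 = <-irrefl (trans (sym F0≡b+1) (trans (cong F (sym u≡0)) Fu≡b+2)) (n<1+n (suc b))
      u≢1 : u ≢ 1
      u≢1 u≡1 = <-irrefl (trans (sym Fu≡b+2) (cong F u≡1)) b+2<F1
      1<u : 1 < u
      1<u = ≤∧≢⇒< (n≢0⇒n>0 u≢0) (u≢1 ∘ sym)
      u<Fu : u < F u
      u<Fu = subst (u <_) (sym Fu≡b+2) (s≤s (m≤n⇒m≤1+n u≤b))
      Fu<F1 : F u < F 1
      Fu<F1 = subst (_< F 1) (sym Fu≡b+2) b+2<F1

  -- If F exchanges overlapping segments [a, b] and [c, d] with
  -- a ≤ c ≤ b < d < A, then their union is stable, so a = 0; now c = 0 makes
  -- [0, b] stable, and c > 0 is excluded by overlapExchangeFrom0.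
  overlappingExchange : ∀ {a b c d} → a ≤ c → c ≤ b → b < d → d < A →
    MapsInto F a b c d → MapsInto F c d a b → a ≡ 0 × suc b ≡ A
  overlappingExchange {a} {b} {c} {d} a≤c c≤b b<d d<A into out
    with stableStartsAt0 (≤-trans a≤c (≤-trans c≤b (<⇒≤ b<d))) d<A
           (exchangedUnionStable a≤c c≤b (<⇒≤ b<d) into out)
  ... | refl with c ≟ 0
  ...   | yes refl = stableIsBlock z≤n (<-trans b<d d<A)
                       (λ (_ , t≤b) → out (z≤n , ≤-trans t≤b (<⇒≤ b<d)))
  ...   | no c≢0 = ⊥-elim (overlapExchangeFrom0 (n≢0⇒n>0 c≢0) c≤b b<d d<A into out)

  -- If F exchanges [a, b] and [c, d] with a < b, a ≤ c and b, d < A, then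
  -- [a, b] is the block: the segments are disjoint, nested or overlapping.
  alignedExchange : ∀ {a b c d} → a < b → a ≤ c → b < A → d < A →
    MapsInto F a b c d → MapsInto F c d a b → a ≡ 0 × suc b ≡ A
  alignedExchange {a} {b} {c} {d} a<b a≤c b<A d<A into out with b <? c | d ≤? b
  ... | yes b<c | _ = ⊥-elim (disjointExchange a<b b<c into out)
  ... | no _ | yes d≤b =
    stableIsBlock (<⇒≤ a<b) b<A
      (λ t∈ → let (c≤Ft , Ft≤d) = into t∈ in ≤-trans a≤c c≤Ft , ≤-trans Ft≤d d≤b)
  ... | no b≮c | no d≰b = overlappingExchange a≤c (≮⇒≥ b≮c) (≰⇒> d≰b) d<A into out

  -- The same without a ≤ c: if c < a, the aligned case applied to the
  -- exchanged pair ([c, d], [a, b]) makes [c, d] = [0, A - 1], and then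
  -- [a, b] would be a stable segment not starting at 0.
  exchangeIsBlock : ∀ {a b c d} → a < b → c ≤ d → b < A → d < A →
    MapsInto F a b c d → MapsInto F c d a b → a ≡ 0 × suc b ≡ A
  exchangeIsBlock {a} {b} {c} {d} a<b c≤d b<A d<A into out with a ≤? c
  ... | yes a≤c = alignedExchange a<b a≤c b<A d<A into out
  ... | no a≰c = ⊥-elim (startsBelow (alignedExchange c<d (<⇒≤ c<a) d<A b<A out into))
    where
    c<a : c < a
    c<a = ≰⇒> a≰c
    pinned : ∀ {v} → c ≡ d → v ∈[ c , d ] → v ≡ c
    pinned c≡d (c≤v , v≤d) = ≤-antisym (subst (_ ≤_) (sym c≡d) v≤d) c≤v
    c<d : c < d
    c<d = ≤∧≢⇒< c≤d (λ c≡d → <⇒≢ a<b (injective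
            (trans (pinned c≡d (into (≤-refl , <⇒≤ a<b)))
                   (sym (pinned c≡d (into (<⇒≤ a<b , ≤-refl)))))))
    startsBelow : c ≡ 0 × suc d ≡ A → ⊥
    startsBelow (c≡0 , d+1≡A) =
      <⇒≢ (subst (_< a) c≡0 c<a)
        (sym (stableStartsAt0 (<⇒≤ a<b) b<A
               (λ (_ , t≤b) → out (subst (_≤ _) (sym c≡0) z≤n ,
                                   ≤-pred (subst (_ <_) (sym d+1≡A) (≤-<-trans t≤b b<A))))))

  -- An interval [x, y] with x < y < A is exchanged by F with the segment
  -- between its least and greatest value, hence it is the block.
  intervalIsBlock : ∀ {x y} → x < y → y < A → IsSegmentInterval F x y →
    x ≡ 0 × suc y ≡ A
  intervalIsBlock {x} {y} x<y y<A interval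
    with extremum {λ p q → F p ≤ F q} (λ p q → ≤-total (F p) (F q)) ≤-trans (≤⇒≤′ (<⇒≤ x<y))
       | extremum {λ p q → F q ≤ F p} (λ p q → ≤-total (F q) (F p))
                  (λ Fq≤Fp Fr≤Fq → ≤-trans Fr≤Fq Fq≤Fp) (≤⇒≤′ (<⇒≤ x<y))
  ... | i , i∈ , lowest | j , j∈ , highest =
    exchangeIsBlock x<y (lowest j∈) y<A (closedA (≤-<-trans (proj₂ j∈) y<A)) into out
    where
    into : MapsInto F x y (F i) (F j)
    into t∈ = lowest t∈ , highest t∈
    out : MapsInto F (F i) (F j) x y
    out (Fi≤t , t≤Fj) with interval i∈ j∈ Fi≤t t≤Fj
    ... | k , k∈ , Fk≡t = subst (_∈[ x , y ]) (sym (swap Fk≡t)) k∈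

  blockIntervalsTrivial : ∀ {x y} → x ≤ y → y < A → IsSegmentInterval F x y →
    x ≡ y ⊎ (x ≡ 0 × suc y ≡ A)
  blockIntervalsTrivial x≤y y<A interval with m≤n⇒m<n∨m≡n x≤y
  ... | inj₂ x≡y = inj₁ x≡y
  ... | inj₁ x<y = inj₂ (intervalIsBlock x<y y<A interval)

finView : ∀ {m t} → t < m → Σ (Fin m) λ i → toℕ i ≡ t
finView t<m = fromℕ< t<m , toℕ-fromℕ< t<m

segmentInterval : ∀ {m} (σ : Permutation′ m) (G : ℕ → ℕ) →
  (∀ i → G (toℕ i) ≡ toℕ (σ ⟨$⟩ʳ i)) →
  ∀ {x y} → y < m → IsInterval σ x y → IsSegmentInterval G x y
segmentInterval {m} σ G describes {x} {y} y<m interval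
  {i} {j} {v} (x≤i , i≤y) (x≤j , j≤y) Gi≤v v≤Gj
  with finView (≤-<-trans i≤y y<m) | finView (≤-<-trans j≤y y<m)
... | i′ , refl | j′ , refl
  with finView (≤-<-trans v≤Gj (subst (_< m) (sym (describes j′)) (toℕ<n (σ ⟨$⟩ʳ j′))))
...   | v′ , refl
  with interval i′ j′ v′ x≤i i≤y x≤j j≤y
         (subst (_≤ toℕ v′) (describes i′) Gi≤v) (subst (toℕ v′ ≤_) (describes j′) v≤Gj)
...     | k , x≤k , k≤y , σk≡v = toℕ k , (x≤k , k≤y) , trans (describes k) (cong toℕ σk≡v)

simpleFromSegments : ∀ {m} (σ : Permutation′ m) (G : ℕ → ℕ) →
  (∀ i → G (toℕ i) ≡ toℕ (σ ⟨$⟩ʳ i)) →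
  (∀ {x y} → x ≤ y → y < m → IsSegmentInterval G x y → x ≡ y ⊎ (x ≡ 0 × suc y ≡ m)) →
  IsSimple σ
simpleFromSegments σ G describes trivial a b a≤b b<m interval =
  trivial a≤b b<m (segmentInterval σ G describes b<m interval)

restrict : (G : ℕ → ℕ) → ∀ {m} → ClosedPrefix G m → (∀ {t} → t < m → G (G t) ≡ t) →
  Σ (Permutation′ m) λ σ → ∀ i → G (toℕ i) ≡ toℕ (σ ⟨$⟩ʳ i)
restrict G {m} closed involutive = permutation g g g∘g g∘g , λ i → sym (toℕ-fromℕ< _)
  where
  g : Fin m → Fin m
  g i = fromℕ< (closed (toℕ<n i))
  g∘g : ∀ i → g (g i) ≡ i
  g∘g i = toℕ-injective
    (trans (toℕ-fromℕ< _) (trans (cong G (toℕ-fromℕ< _)) (involutive (toℕ<n i))))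

extend : ∀ {n} → Permutation′ n → ℕ → ℕ
extend {n} π t with t <? n
... | yes t<n = toℕ (π ⟨$⟩ʳ fromℕ< t<n)
... | no _ = t

module Extension {n : ℕ} (π : Permutation′ n) where

  F : ℕ → ℕ
  F = extend π

  extendToℕ : ∀ i → F (toℕ i) ≡ toℕ (π ⟨$⟩ʳ i)
  extendToℕ i with toℕ i <? n
  ... | yes i<n = cong (λ p → toℕ (π ⟨$⟩ʳ p)) (fromℕ<-toℕ i i<n)
  ... | no i≮n = contradiction (toℕ<n i) i≮n

  positionView : ∀ t → (Σ (Fin n) λ i → toℕ i ≡ t) ⊎ (n ≤ t × F t ≡ t)
  positionView t with t <? n
  ... | yes t<n = inj₁ (finView t<n)
  ... | no t≮n = inj₂ (≮⇒≥ t≮n , refl)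

  extendClosed : ClosedPrefix F n
  extendClosed t<n with finView t<n
  ... | i , refl = subst (_< n) (sym (extendToℕ i)) (toℕ<n (π ⟨$⟩ʳ i))

  extendBelow : ∀ {j k} → j < k → n ≤ k → F j < k
  extendBelow {j} j<k n≤k with positionView j
  ... | inj₁ (i , refl) = <-≤-trans (extendClosed (toℕ<n i)) n≤k
  ... | inj₂ (_ , Fj≡j) = subst (_< _) (sym Fj≡j) j<k

  applyEq : ∀ {p q} → F (toℕ p) ≡ toℕ q → π ⟨$⟩ʳ p ≡ q
  applyEq {p} Fp≡q = toℕ-injective (trans (sym (extendToℕ p)) Fp≡q)

  extendInvolutive : IsInvolution π → ∀ t → F (F t) ≡ t
  extendInvolutive involutive t with positionView t
  ... | inj₂ (_ , Ft≡t) = trans (cong F Ft≡t) Ft≡t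
  ... | inj₁ (i , refl) = begin
    F (F (toℕ i))            ≡⟨ cong F (extendToℕ i) ⟩
    F (toℕ (π ⟨$⟩ʳ i))       ≡⟨ extendToℕ (π ⟨$⟩ʳ i) ⟩
    toℕ (π ⟨$⟩ʳ (π ⟨$⟩ʳ i)) ≡⟨ cong toℕ (involutive i) ⟩
    toℕ i                    ∎
    where open ≡-Reasoning

  extendFixedPointFree : FixedPointFree π → ∀ {t} → t < n → F t ≢ t
  extendFixedPointFree fixedPointFree t<n Ft≡t with finView t<n
  ... | i , refl = fixedPointFree i (applyEq Ft≡t)

  extendAvoids321 : Avoids321 π →
    ∀ {i j k} → i < j → j < k → F j < F i → F k < F j → ⊥
  extendAvoids321 avoids {i} {j} {k} i<j j<k Fj<Fi Fk<Fj with positionView k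
  ... | inj₂ (n≤k , Fk≡k) = <-asym (extendBelow j<k n≤k) (subst (_< F j) Fk≡k Fk<Fj)
  ... | inj₁ (k′ , refl)
    with finView (<-trans i<j (<-trans j<k (toℕ<n k′))) | finView (<-trans j<k (toℕ<n k′))
  ...   | i′ , refl | j′ , refl =
    avoids (i′ , j′ , k′ , i<j , j<k ,
            subst₂ _<_ (extendToℕ j′) (extendToℕ i′) Fj<Fi ,
            subst₂ _<_ (extendToℕ k′) (extendToℕ j′) Fk<Fj)

  extendNoSymmetricConnection : ¬ HasSymmetricConnections π →
    ∀ {p} → p < F p → suc p < F (suc p) → F (suc p) ≡ suc (F p) → ⊥
  extendNoSymmetricConnection noSymmetric {p} p<Fp p+1<F[p+1] adjacent
    with positionView (suc p)
  ... | inj₂ (_ , F[p+1]≡p+1) = <-irrefl (sym F[p+1]≡p+1) p+1<F[p+1]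
  ... | inj₁ (q , q≡p+1) with finView (<-trans (n<1+n p) (subst (_< n) q≡p+1 (toℕ<n q)))
  ...   | p′ , refl =
    noSymmetric (p′ , q , q≡p+1 ,
      subst (toℕ p′ <_) (extendToℕ p′) p<Fp ,
      subst (toℕ q <_) (extendToℕ q) (subst (λ s → s < F s) (sym q≡p+1) p+1<F[p+1]) ,
      inj₁ (begin
        toℕ (π ⟨$⟩ʳ q)      ≡⟨ sym (extendToℕ q) ⟩
        F (toℕ q)           ≡⟨ cong F q≡p+1 ⟩
        F (suc (toℕ p′))    ≡⟨ adjacent ⟩
        suc (F (toℕ p′))    ≡⟨ cong suc (extendToℕ p′) ⟩
        suc (toℕ (π ⟨$⟩ʳ p′)) ∎))
    where open ≡-Reasoning

  secondBlock : IsInvolution π → ∀ {A B} → A + B ≡ n → ClosedPrefix F A →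
    Σ (Permutation′ B) λ α₂ → ∀ j → A + toℕ (α₂ ⟨$⟩ʳ j) ≡ F (A + toℕ j)
  secondBlock involutive {A} {B} A+B≡n closedA =
    proj₁ restricted ,
    λ j → trans (cong (A +_) (sym (proj₂ restricted j))) (m+[n∸m]≡n (beyondA (toℕ j)))
    where
    open Involution F (extendInvolutive involutive)
    shifted : ℕ → ℕ
    shifted t = F (A + t) ∸ A
    beyondA : ∀ t → A ≤ F (A + t)
    beyondA t = beyondClosedPrefix closedA (m≤m+n A t)
    shiftedClosed : ClosedPrefix shifted B
    shiftedClosed {t} t<B = subst (shifted t <_) (m+n∸m≡n A B)
      (∸-monoˡ-< (subst (F (A + t) <_) (sym A+B≡n)
                    (extendClosed (subst (A + t <_) A+B≡n (+-monoʳ-< A t<B))))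
                 (beyondA t))
    shiftedInvolutive : ∀ {t} → t < B → shifted (shifted t) ≡ t
    shiftedInvolutive {t} _ = begin
      F (A + (F (A + t) ∸ A)) ∸ A ≡⟨ cong (λ s → F s ∸ A) (m+[n∸m]≡n (beyondA t)) ⟩
      F (F (A + t)) ∸ A           ≡⟨ cong (_∸ A) (extendInvolutive involutive (A + t)) ⟩
      A + t ∸ A                   ≡⟨ m+n∸m≡n A t ⟩
      t                           ∎
      where open ≡-Reasoning
    restricted = restrict shifted shiftedClosed shiftedInvolutive

  splitAtClosedPrefix : IsInvolution π → ∀ {A B} (A+B≡n : A + B ≡ n) → ClosedPrefix F A →
    Σ (Permutation′ A) λ α₁ → Σ (Permutation′ B) λ α₂ →
      Is12Sum A+B≡n π α₁ α₂ × (∀ i → F (toℕ i) ≡ toℕ (α₁ ⟨$⟩ʳ i))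
  splitAtClosedPrefix involutive {A} {B} A+B≡n closedA
    with restrict F closedA (λ {t} _ → extendInvolutive involutive t)
       | secondBlock involutive A+B≡n closedA
  ... | α₁ , describes₁ | α₂ , describes₂ = α₁ , α₂ , (onFirst , onSecond) , describes₁
    where
    open ≡-Reasoning
    position₁ : ∀ i → toℕ (cast A+B≡n (i ↑ˡ B)) ≡ toℕ i
    position₁ i = trans (toℕ-cast A+B≡n _) (toℕ-↑ˡ i B)
    position₂ : ∀ j → toℕ (cast A+B≡n (A ↑ʳ j)) ≡ A + toℕ j
    position₂ j = trans (toℕ-cast A+B≡n _) (toℕ-↑ʳ A j)
    onFirst : ∀ i → π ⟨$⟩ʳ cast A+B≡n (i ↑ˡ B) ≡ cast A+B≡n ((α₁ ⟨$⟩ʳ i) ↑ˡ B)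
    onFirst i = applyEq (begin
      F (toℕ (cast A+B≡n (i ↑ˡ B)))          ≡⟨ cong F (position₁ i) ⟩
      F (toℕ i)                              ≡⟨ describes₁ i ⟩
      toℕ (α₁ ⟨$⟩ʳ i)                        ≡⟨ sym (position₁ (α₁ ⟨$⟩ʳ i)) ⟩
      toℕ (cast A+B≡n ((α₁ ⟨$⟩ʳ i) ↑ˡ B))   ∎)
    onSecond : ∀ j → π ⟨$⟩ʳ cast A+B≡n (A ↑ʳ j) ≡ cast A+B≡n (A ↑ʳ (α₂ ⟨$⟩ʳ j))
    onSecond j = applyEq (begin
      F (toℕ (cast A+B≡n (A ↑ʳ j)))          ≡⟨ cong F (position₂ j) ⟩
      F (A + toℕ j)                          ≡⟨ sym (describes₂ j) ⟩
      A + toℕ (α₂ ⟨$⟩ʳ j)                    ≡⟨ sym (position₂ (α₂ ⟨$⟩ʳ j)) ⟩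
      toℕ (cast A+B≡n (A ↑ʳ (α₂ ⟨$⟩ʳ j)))   ∎)

  firstBlock : IsInvolution π → Avoids321 π → FixedPointFree π →
    ¬ HasSymmetricConnections π → 0 < n →
    ∃[ A ] 0 < A × A ≤ n × ClosedPrefix F A ×
      (∀ {x y} → x ≤ y → y < A → IsSegmentInterval F x y → x ≡ y ⊎ (x ≡ 0 × suc y ≡ A))
  firstBlock involutive avoids fixedPointFree noSymmetric 0<n
    with least (λ L → 0 <? L ×-dec closedPrefix? F L) (0<n , λ {_} → extendClosed)
  ... | A , A≤n , (0<A , closedA) , minimalA =
    A , 0<A , A≤n , (λ {_} → closedA) , blockIntervalsTrivial
    where
    open FirstBlock F (extendInvolutive involutive) (extendAvoids321 avoids)
                    (extendNoSymmetricConnection noSymmetric) A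
                    (λ t<A → extendFixedPointFree fixedPointFree (<-≤-trans t<A A≤n))
                    (λ {_} → closedA) minimalA

theorem6p3 : ∀ (n : ℕ) (π : Permutation′ n) →
    IsInvolution π → Avoids321 π → FixedPointFree π →
    ¬ HasSymmetricConnections π →
    IsSimple π ⊎
    (Σ ℕ λ a → Σ ℕ λ b → Σ (a + b ≡ n) λ e →
      Σ (Permutation′ a) λ α₁ → Σ (Permutation′ b) λ α₂ →
        (0 < a) × (0 < b) × Is12Sum e π α₁ α₂ × IsSimple α₁)
theorem6p3 zero π _ _ _ _ = inj₁ λ _ _ _ ()
theorem6p3 n@(suc _) π involutive avoids fixedPointFree noSymmetric
  with Extension.firstBlock π involutive avoids fixedPointFree noSymmetric z<s
... | A , 0<A , A≤n , closedA , trivialIntervals with m≤n⇒m<n∨m≡n A≤n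
...   | inj₂ refl = inj₁ (simpleFromSegments π (extend π) (Extension.extendToℕ π) trivialIntervals)
...   | inj₁ A<n with Extension.splitAtClosedPrefix π involutive (m+[n∸m]≡n A≤n) closedA
...     | α₁ , α₂ , isSum , describes =
  inj₂ (A , n ∸ A , m+[n∸m]≡n A≤n , α₁ , α₂ , 0<A , m<n⇒0<n∸m A<n , isSum ,
        simpleFromSegments α₁ (extend π) describes trivialIntervals)
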